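{- For every integer $n\ge 0$, the pair $(E_n,\mathcal{B}_n)$ is a matroid whose set of bases is $\mathcal{B}_n$; it has rank $n+3$ and $3n+7$ elements.
   Context: For $n\ge0$ let $E_n=\{1,2,3,4,x_0,\dots,x_n,y_0,\dots,y_n,z_0,\dots,z_n\}$ (a set of $3n+7$ distinct elements), $X=\{x_0,\dots,x_n\}$, $Y=\{y_0,\dots,y_n\}$, $Z=\{z_0,\dots,z_n\}$. Define $H_1=\{1\}\cup Y\cup Z$, $H_2=\{2\}\cup X\cup Z$, $H_3=\{3\}\cup X\cup Y$, $C_1=\{1,4\}\cup X$, $C_2=\{2,4\}\cup Y$, $C_3=\{3,4\}\cup Z$, and $\mathcal{B}_n=\{B\subseteq E_n : |B|=n+3,\ \{1,2,3\}\not\subseteq B,\ B\not\subseteq C_i \text{ and } B\not\subseteq H_i \text{ for all } 1\le i\le 3\}$. -}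

module Defs where

open import Data.Nat using (ℕ; zero; suc; _+_; _*_)
open import Data.Bool using (Bool; true; false; if_then_else_; _∨_)
open import Data.Fin using (Fin; splitAt)
open import Data.Fin.Subset using (Subset; Side; inside; outside; _∈_; _∉_; _⊆_; _-_; _∪_; ⁅_⁆; ∣_∣)
open import Data.Vec using (tabulate)
open import Data.Sum using (_⊎_; inj₁; inj₂)
open import Data.Product using (Σ; ∃; _×_; _,_)
open import Relation.Nullary using (¬_)

record IsMatroidBases {m : ℕ} (𝓑 : Subset m → Set) : Set where
  field
    nonempty : ∃ λ B → 𝓑 B
    exchange : ∀ B₁ B₂ → 𝓑 B₁ → 𝓑 B₂ → ∀ e → e ∈ B₁ → e ∉ B₂ →
               ∃ λ f → f ∈ B₂ × f ∉ B₁ × 𝓑 ((B₁ - e) ∪ ⁅ f ⁆)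

data Elt (n : ℕ) : Set where
  e1 e2 e3 e4 : Elt n
  x y z : Fin (suc n) → Elt n

-- E_n is encoded as Fin (4 + 3 * suc n) (= 3n+7 indices):
-- 0,1,2,3 ↦ 1,2,3,4 ; then x_0..x_n, then y_0..y_n, then z_0..z_n.
E : ℕ → Set
E n = Fin (4 + 3 * suc n)

decode : ∀ {n} → E n → Elt n
decode {n} i with splitAt 4 i
... | inj₁ Fin.zero = e1
... | inj₁ (Fin.suc Fin.zero) = e2
... | inj₁ (Fin.suc (Fin.suc Fin.zero)) = e3
... | inj₁ (Fin.suc (Fin.suc (Fin.suc Fin.zero))) = e4
... | inj₂ j with splitAt (suc n) j
...   | inj₁ a = x a
...   | inj₂ k with splitAt (suc n) k
...     | inj₁ b = y b
...     | inj₂ l with splitAt (suc n) {0} l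
...       | inj₁ c = z c
...       | inj₂ ()

subsetOf : ∀ {n} → (Elt n → Bool) → Subset (4 + 3 * suc n)
subsetOf p = tabulate λ i → if p (decode i) then inside else outside

isX isY isZ : ∀ {n} → Elt n → Bool
isX (x _) = true
isX _ = false
isY (y _) = true
isY _ = false
isZ (z _) = true
isZ _ = false

is : ∀ {n} → Elt n → Elt n → Bool  -- is a b : a is the fixed element b (only for e1..e4)
is e1 e1 = true
is e2 e2 = true
is e3 e3 = true
is e4 e4 = true
is _ _ = false

H₁ H₂ H₃ : ∀ {n} → Subset (4 + 3 * suc n)
H₁ = subsetOf λ a → is a e1 ∨ isY a ∨ isZ a
H₂ = subsetOf λ a → is a e2 ∨ isX a ∨ isZ a
H₃ = subsetOf λ a → is a e3 ∨ isX a ∨ isY a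

C₁ C₂ C₃ : ∀ {n} → Subset (4 + 3 * suc n)
C₁ = subsetOf λ a → is a e1 ∨ is a e4 ∨ isX a
C₂ = subsetOf λ a → is a e2 ∨ is a e4 ∨ isY a
C₃ = subsetOf λ a → is a e3 ∨ is a e4 ∨ isZ a

S123 : ∀ {n} → Subset (4 + 3 * suc n)
S123 = subsetOf λ a → is a e1 ∨ is a e2 ∨ is a e3

𝓑 : ∀ n → Subset (4 + 3 * suc n) → Set
𝓑 n B = ∣ B ∣ ≡ n + 3
      × ¬ (S123 ⊆ B)
      × ¬ (B ⊆ C₁) × ¬ (B ⊆ C₂) × ¬ (B ⊆ C₃)
      × ¬ (B ⊆ H₁) × ¬ (B ⊆ H₂) × ¬ (B ⊆ H₃)
  where open import Relation.Binary.PropositionalEquality using (_≡_)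

module Submission where

-- This is an instance of a general
-- pattern, proved first (module SparseFamily): on a finite ground set, fix a
-- size r, a set S and a family of "forbidden" sets F i such that
--   * distinct F i, F j share fewer than r − 1 elements, and
--   * S has two distinct elements outside every F i.
-- Then the r-sets B with S ⊄ B and B ⊄ F i for all i satisfy the basis exchange
-- axiom.  For e ∈ B₁ ∖ B₂ put A = B₁ - e: if A lies in some F i, any
-- f ∈ B₂ ∖ F i can be added to A; otherwise some f₀ ∈ B₂ ∖ A works unless
-- A ∪ {f₀} covers S, and then any g ∈ B₂ ∖ (A ∪ {f₀}) works.
-- For E_n (module Construction) the hypotheses are checked by counting: every
-- set involved is described by a predicate constant on the blocks X, Y, Z, so
-- its size is (number of the points 1,2,3,4 chosen) + (n+1)·(number of blocks
-- chosen); the 30 pairwise intersections are then bounded by evaluation.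

open import Defs
open import Data.Nat using (ℕ; zero; suc; _+_; _*_; _≤_; _<_; z≤n; s≤s; s≤s⁻¹; _≤?_)
open import Data.Nat.Properties
  using (≤-trans; ≤-reflexive; <⇒≱; <-irrefl; n<1+n; +-comm; +-assoc; +-identityʳ;
         *-zeroʳ; *-identityʳ; *-suc; *-distribˡ-+; module ≤-Reasoning)
open import Data.Bool using (Bool; true; false; _∧_; _∨_; if_then_else_)
open import Data.Bool.Properties using (not-¬)
open import Data.Fin using (Fin; zero; suc; _≟_; _↑ˡ_; _↑ʳ_)
open import Data.Fin.Properties using (any?; all?; ¬∀⟶∃¬; splitAt-↑ˡ; splitAt-↑ʳ)
open import Data.Fin.Subset using (Subset; ⊤; _∈_; _∉_; _⊆_; _-_; _∪_; _∩_; ⁅_⁆; ∣_∣)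
open import Data.Fin.Subset.Properties
  using (_∈?_; _⊆?_; p─⊥≡p; ∪-identityʳ; x∈p∪q⁻; x∈p∪q⁺; x∈⁅x⁆; x∈⁅y⁆⇒x≡y; x≢y⇒x∉⁅y⁆;
         x∈p∧x∉q⇒x∈p─q; p─q⊆p; p⊆p∪q; p⊆q⇒∣p∣≤∣q∣; p⊂q⇒∣p∣<∣q∣; x∈p∩q⁺; ∣⊤∣≡n)
open import Data.Vec using ([]; _∷_; here; there; tabulate)
open import Data.Vec.Properties using (tabulate-cong; lookup∘tabulate; lookup⇒[]=; []=⇒lookup)
open import Data.Sum using (inj₁; inj₂)
open import Data.Product using (∃; ∃₂; _×_; _,_; proj₁; proj₂)
open import Relation.Nullary using (¬_; yes; no; contradiction)
open import Relation.Nullary.Decidable using (_→-dec_; ¬?; toWitness)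
open import Relation.Binary.PropositionalEquality
  using (_≡_; _≢_; refl; sym; trans; cong; cong₂; subst; module ≡-Reasoning)

∣p-i∣ : ∀ {m} (p : Subset m) {i} → i ∈ p → suc ∣ p - i ∣ ≡ ∣ p ∣
∣p-i∣ (true ∷ p) here = cong (λ q → suc ∣ q ∣) (p─⊥≡p p)
∣p-i∣ (true ∷ p) (there i∈p) = cong suc (∣p-i∣ p i∈p)
∣p-i∣ (false ∷ p) (there i∈p) = ∣p-i∣ p i∈p

∣p∪⁅i⁆∣ : ∀ {m} (p : Subset m) {i} → i ∉ p → ∣ p ∪ ⁅ i ⁆ ∣ ≡ suc ∣ p ∣
∣p∪⁅i⁆∣ (true ∷ p) {zero} i∉p = contradiction here i∉p
∣p∪⁅i⁆∣ (false ∷ p) {zero} i∉p = cong (λ q → suc ∣ q ∣) (∪-identityʳ p)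
∣p∪⁅i⁆∣ (true ∷ p) {suc i} i∉p = cong suc (∣p∪⁅i⁆∣ p (λ i∈p → i∉p (there i∈p)))
∣p∪⁅i⁆∣ (false ∷ p) {suc i} i∉p = ∣p∪⁅i⁆∣ p (λ i∈p → i∉p (there i∈p))

∣B-e∪⁅f⁆∣ : ∀ {m} (B : Subset m) {e f} → e ∈ B → f ∉ B - e → ∣ (B - e) ∪ ⁅ f ⁆ ∣ ≡ ∣ B ∣
∣B-e∪⁅f⁆∣ B e∈B f∉B-e = trans (∣p∪⁅i⁆∣ (B - _) f∉B-e) (∣p-i∣ B e∈B)

-- A failed inclusion has a witness; membership is decidable, so this is constructive.
⊈⇒∃ : ∀ {m} {p q : Subset m} → ¬ p ⊆ q → ∃ λ i → i ∈ p × i ∉ q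
⊈⇒∃ {m} {p} {q} p⊈q
  with ¬∀⟶∃¬ m (λ i → i ∈ p → i ∈ q) (λ i → i ∈? p →-dec i ∈? q) (λ p⊆q → p⊈q (p⊆q _))
... | i , ¬[i∈p⇒i∈q] with i ∈? p
...   | yes i∈p = i , i∈p , λ i∈q → ¬[i∈p⇒i∈q] (λ _ → i∈q)
...   | no i∉p = contradiction (λ i∈p → contradiction i∈p i∉p) ¬[i∈p⇒i∈q]

⊈-smaller : ∀ {m} {p q : Subset m} → ∣ q ∣ < ∣ p ∣ → ¬ p ⊆ q
⊈-smaller ∣q∣<∣p∣ p⊆q = <⇒≱ ∣q∣<∣p∣ (p⊆q⇒∣p∣≤∣q∣ p⊆q)

∈∪⁅j⁆-∉⇒≡ : ∀ {m} {p : Subset m} {i j} → i ∈ p ∪ ⁅ j ⁆ → i ∉ p → i ≡ j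
∈∪⁅j⁆-∉⇒≡ {p = p} {j = j} i∈p∪j i∉p with x∈p∪q⁻ p ⁅ j ⁆ i∈p∪j
... | inj₁ i∈p = contradiction i∈p i∉p
... | inj₂ i∈⁅j⁆ = x∈⁅y⁆⇒x≡y j i∈⁅j⁆

j∈p∪⁅j⁆ : ∀ {m} (p : Subset m) j → j ∈ p ∪ ⁅ j ⁆
j∈p∪⁅j⁆ p j = x∈p∪q⁺ (inj₂ (x∈⁅x⁆ j))

∉p-j⇒∉p : ∀ {m} {p : Subset m} {i j} → i ∉ p - j → i ≢ j → i ∉ p
∉p-j⇒∉p i∉p-j i≢j i∈p = i∉p-j (x∈p∧x∉q⇒x∈p─q i∈p (x≢y⇒x∉⁅y⁆ i≢j))

IsMatroidBases-resp : ∀ {m} {P Q : Subset m → Set} →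
  (∀ {B} → P B → Q B) → (∀ {B} → Q B → P B) → IsMatroidBases P → IsMatroidBases Q
IsMatroidBases-resp P⇒Q Q⇒P bases = record
  { nonempty = let (B , pB) = nonempty in B , P⇒Q pB
  ; exchange = λ B₁ B₂ qB₁ qB₂ e e∈B₁ e∉B₂ →
      let (f , f∈B₂ , f∉B₁ , pB) = exchange B₁ B₂ (Q⇒P qB₁) (Q⇒P qB₂) e e∈B₁ e∉B₂
      in f , f∈B₂ , f∉B₁ , P⇒Q pB
  }
  where open IsMatroidBases bases

module SparseFamily {m k : ℕ} (r : ℕ) (S : Subset m) (F : Fin k → Subset m) where

  IsBasis : Subset m → Set
  IsBasis B = ∣ B ∣ ≡ r × ¬ S ⊆ B × (∀ i → ¬ B ⊆ F i)

  TwoOutside : Fin k → Set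
  TwoOutside i = ∃₂ λ a b → a ≢ b × a ∈ S × b ∈ S × a ∉ F i × b ∉ F i

  Exchange : Subset m → Subset m → Fin m → Set
  Exchange B₁ B₂ e = ∃ λ f → f ∈ B₂ × f ∉ B₁ × IsBasis ((B₁ - e) ∪ ⁅ f ⁆)

  module _ (smallMeets : ∀ i j → i ≢ j → suc ∣ F i ∩ F j ∣ < r)
           (escape : ∀ i → TwoOutside i) where

    exchangeWith : ∀ {B₁ B₂ e f} → ∣ B₁ ∣ ≡ r → e ∈ B₁ → e ∉ B₂ → f ∈ B₂ → f ∉ B₁ - e →
      ¬ S ⊆ (B₁ - e) ∪ ⁅ f ⁆ → (∀ i → ¬ (B₁ - e) ∪ ⁅ f ⁆ ⊆ F i) → Exchange B₁ B₂ e
    exchangeWith {B₁} {e = e} ∣B₁∣ e∈B₁ e∉B₂ f∈B₂ f∉A S⊈ ⊈F =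
      _ , f∈B₂ , ∉p-j⇒∉p f∉A (λ { refl → e∉B₂ f∈B₂ }) ,
      trans (∣B-e∪⁅f⁆∣ B₁ e∈B₁ f∉A) ∣B₁∣ , S⊈ , ⊈F

    module _ {B₁ B₂ e} (b₁ : IsBasis B₁) (b₂ : IsBasis B₂) (e∈B₁ : e ∈ B₁) (e∉B₂ : e ∉ B₂) where
      private
        A = B₁ - e
        1+∣A∣≡r : suc ∣ A ∣ ≡ r
        1+∣A∣≡r = trans (∣p-i∣ B₁ e∈B₁) (proj₁ b₁)

      -- Any f ∈ B₂ ∖ F i works: A ∪ ⁅ f ⁆ ⊆ F j with
      -- j ≢ i would squeeze A into the small set F i ∩ F j, and the two
      -- elements of S outside F i cannot both be f.
      exchangeInFlat : ∀ i → A ⊆ F i → Exchange B₁ B₂ e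
      exchangeInFlat i A⊆Fi with ⊈⇒∃ (proj₂ (proj₂ b₂) i)
      ... | f , f∈B₂ , f∉Fi =
        exchangeWith (proj₁ b₁) e∈B₁ e∉B₂ f∈B₂ (λ f∈A → f∉Fi (A⊆Fi f∈A)) S⊈ ⊈F
        where
        S⊈ : ¬ S ⊆ A ∪ ⁅ f ⁆
        S⊈ S⊆ with escape i
        ... | a , b , a≢b , a∈S , b∈S , a∉Fi , b∉Fi =
          a≢b (trans (∈∪⁅j⁆-∉⇒≡ (S⊆ a∈S) (λ a∈A → a∉Fi (A⊆Fi a∈A)))
                     (sym (∈∪⁅j⁆-∉⇒≡ (S⊆ b∈S) (λ b∈A → b∉Fi (A⊆Fi b∈A)))))
        ⊈F : ∀ j → ¬ A ∪ ⁅ f ⁆ ⊆ F j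
        ⊈F j A∪f⊆Fj with i ≟ j
        ... | yes refl = f∉Fi (A∪f⊆Fj (j∈p∪⁅j⁆ A f))
        ... | no i≢j =
          ⊈-smaller (s≤s⁻¹ (≤-trans (smallMeets i j i≢j) (≤-reflexive (sym 1+∣A∣≡r))))
                    (λ a∈A → x∈p∩q⁺ (A⊆Fi a∈A , A∪f⊆Fj (p⊆p∪q ⁅ f ⁆ a∈A)))

      offFlats : (∀ i → ¬ A ⊆ F i) → ∀ f i → ¬ A ∪ ⁅ f ⁆ ⊆ F i
      offFlats A⊈F f i A∪f⊆Fi = A⊈F i (λ a∈A → A∪f⊆Fi (p⊆p∪q ⁅ f ⁆ a∈A))

      -- At most one element can be added to A to cover S, namely an element
      -- of S outside B₁.
      coverUnique : ∀ {f g} → S ⊆ A ∪ ⁅ f ⁆ → S ⊆ A ∪ ⁅ g ⁆ → f ≡ g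
      coverUnique S⊆A∪f S⊆A∪g with ⊈⇒∃ (proj₁ (proj₂ b₁))
      ... | t , t∈S , t∉B₁ =
        trans (sym (∈∪⁅j⁆-∉⇒≡ (S⊆A∪f t∈S) t∉A)) (∈∪⁅j⁆-∉⇒≡ (S⊆A∪g t∈S) t∉A)
        where
        t∉A : t ∉ A
        t∉A t∈A = t∉B₁ (p─q⊆p B₁ ⁅ e ⁆ t∈A)

      -- If A ∪ ⁅ f ⁆ covers S, it does not contain B₂: B₂ would be a proper
      -- subset (missing a point of S) of a set of its own size r.
      B₂⊈cover : ∀ {f} → f ∉ A → S ⊆ A ∪ ⁅ f ⁆ → ¬ B₂ ⊆ A ∪ ⁅ f ⁆
      B₂⊈cover f∉A S⊆A∪f B₂⊆A∪f with ⊈⇒∃ (proj₁ (proj₂ b₂))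
      ... | t , t∈S , t∉B₂ =
        <-irrefl (trans (proj₁ b₂) (sym (trans (∣B-e∪⁅f⁆∣ B₁ e∈B₁ f∉A) (proj₁ b₁))))
                 (p⊂q⇒∣p∣<∣q∣ (B₂⊆A∪f , t , S⊆A∪f t∈S , t∉B₂))

      -- Take f₀ ∈ B₂ ∖ A (B₂ is larger than A).  If
      -- A ∪ ⁅ f₀ ⁆ does not cover S we are done; otherwise any
      -- g ∈ B₂ ∖ (A ∪ ⁅ f₀ ⁆) works, since A ∪ ⁅ g ⁆ cannot cover S as well.
      exchangeOffFlats : (∀ i → ¬ A ⊆ F i) → Exchange B₁ B₂ e
      exchangeOffFlats A⊈F with ⊈⇒∃ (⊈-smaller (≤-reflexive (trans 1+∣A∣≡r (sym (proj₁ b₂)))))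
      ... | f₀ , f₀∈B₂ , f₀∉A with S ⊆? A ∪ ⁅ f₀ ⁆
      ...   | no S⊈A∪f₀ =
        exchangeWith (proj₁ b₁) e∈B₁ e∉B₂ f₀∈B₂ f₀∉A S⊈A∪f₀ (offFlats A⊈F f₀)
      ...   | yes S⊆A∪f₀ with ⊈⇒∃ (B₂⊈cover f₀∉A S⊆A∪f₀)
      ...     | g , g∈B₂ , g∉A∪f₀ =
        exchangeWith (proj₁ b₁) e∈B₁ e∉B₂ g∈B₂ (λ g∈A → g∉A∪f₀ (p⊆p∪q ⁅ f₀ ⁆ g∈A))
          (λ S⊆A∪g → g∉A∪f₀ (subst (_∈ A ∪ ⁅ f₀ ⁆) (coverUnique S⊆A∪f₀ S⊆A∪g) (j∈p∪⁅j⁆ A f₀)))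
          (offFlats A⊈F g)

    exchange : ∀ B₁ B₂ → IsBasis B₁ → IsBasis B₂ → ∀ e → e ∈ B₁ → e ∉ B₂ → Exchange B₁ B₂ e
    exchange B₁ B₂ b₁ b₂ e e∈B₁ e∉B₂ with any? (λ i → B₁ - e ⊆? F i)
    ... | yes (i , A⊆Fi) = exchangeInFlat b₁ b₂ e∈B₁ e∉B₂ i A⊆Fi
    ... | no A⊈F = exchangeOffFlats b₁ b₂ e∈B₁ e∉B₂ (λ i A⊆Fi → A⊈F (i , A⊆Fi))

    isMatroidBases : ∃ IsBasis → IsMatroidBases IsBasis
    isMatroidBases B₀ = record { nonempty = B₀ ; exchange = exchange }

bit : Bool → ℕ
bit true = 1
bit false = 0

∣b∷p∣ : ∀ {k} b (p : Subset k) → ∣ b ∷ p ∣ ≡ bit b + ∣ p ∣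
∣b∷p∣ true p = refl
∣b∷p∣ false p = refl

∣tabulate-+∣ : ∀ a {b} (f : Fin (a + b) → Bool) →
  ∣ tabulate f ∣ ≡ ∣ tabulate (λ i → f (i ↑ˡ b)) ∣ + ∣ tabulate (λ j → f (a ↑ʳ j)) ∣
∣tabulate-+∣ zero f = refl
∣tabulate-+∣ (suc a) {b} f = begin
  ∣ tabulate f ∣                              ≡⟨ ∣b∷p∣ (f zero) (tabulate f′) ⟩
  bit (f zero) + ∣ tabulate f′ ∣              ≡⟨ cong (bit (f zero) +_) (∣tabulate-+∣ a f′) ⟩
  bit (f zero) + (∣ tabulate left′ ∣ + right) ≡⟨ +-assoc (bit (f zero)) _ right ⟨
  bit (f zero) + ∣ tabulate left′ ∣ + right   ≡⟨ cong (_+ right) (∣b∷p∣ (f zero) (tabulate left′)) ⟨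
  ∣ tabulate (λ i → f (i ↑ˡ b)) ∣ + right     ∎
  where
  open ≡-Reasoning
  f′ : Fin (a + b) → Bool
  f′ i = f (suc i)
  left′ : Fin a → Bool
  left′ i = f′ (i ↑ˡ b)
  right : ℕ
  right = ∣ tabulate (λ j → f (suc a ↑ʳ j)) ∣

∣tabulate-const∣ : ∀ k c → ∣ tabulate {n = k} (λ _ → c) ∣ ≡ k * bit c
∣tabulate-const∣ zero c = refl
∣tabulate-const∣ (suc k) c =
  trans (∣b∷p∣ c (tabulate {n = k} (λ _ → c))) (cong (bit c +_) (∣tabulate-const∣ k c))

tabulate-∩ : ∀ {k} (f g : Fin k → Bool) → tabulate f ∩ tabulate g ≡ tabulate (λ i → f i ∧ g i)
tabulate-∩ {zero} f g = refl
tabulate-∩ {suc k} f g = cong (f zero ∧ g zero ∷_) (tabulate-∩ (λ i → f (suc i)) (λ i → g (suc i)))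

-- If a + b ≤ 1, then a + N·b ≤ N for every positive N: the size bound for a
-- set made of at most one point or at most one block of size N.
thin-bound : ∀ {a b} k → a + b ≤ 1 → a + suc k * b ≤ suc k
thin-bound {zero} {zero} k _ = subst (_≤ suc k) (sym (*-zeroʳ k)) z≤n
thin-bound {suc zero} {zero} k _ = s≤s (subst (_≤ k) (sym (*-zeroʳ k)) z≤n)
thin-bound {zero} {suc zero} k _ = ≤-reflexive (*-identityʳ (suc k))
thin-bound {suc zero} {suc _} k (s≤s ())
thin-bound {suc (suc _)} k (s≤s ())
thin-bound {zero} {suc (suc _)} k (s≤s ())

module Construction (n : ℕ) where

  K : ℕ
  K = suc n

  Pred : Set
  Pred = Elt n → Bool

  _∧ᵖ_ : Pred → Pred → Pred
  (p ∧ᵖ q) a = p a ∧ q a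

  subsetOf-tabulate : ∀ p → subsetOf p ≡ tabulate (λ i → p (decode {n} i))
  subsetOf-tabulate p = tabulate-cong (λ i → if-id (p (decode {n} i)))
    where
    if-id : ∀ b → (if b then true else false) ≡ b
    if-id true = refl
    if-id false = refl

  ∈-subsetOf⁺ : ∀ p {i} → p (decode i) ≡ true → i ∈ subsetOf p
  ∈-subsetOf⁺ p {i} pi≡true =
    subst (i ∈_) (sym (subsetOf-tabulate p))
          (lookup⇒[]= i _ (trans (lookup∘tabulate (λ j → p (decode {n} j)) i) pi≡true))

  ∈-subsetOf⁻ : ∀ p {i} → i ∈ subsetOf p → p (decode i) ≡ true
  ∈-subsetOf⁻ p {i} i∈p =
    trans (sym (lookup∘tabulate (λ j → p (decode {n} j)) i))
          ([]=⇒lookup (subst (i ∈_) (subsetOf-tabulate p) i∈p))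

  ∉-subsetOf : ∀ p {i} → p (decode i) ≡ false → i ∉ subsetOf p
  ∉-subsetOf p pi≡false i∈p = not-¬ (∈-subsetOf⁻ p i∈p) pi≡false

  subsetOf-∩ : ∀ p q → subsetOf p ∩ subsetOf q ≡ subsetOf (p ∧ᵖ q)
  subsetOf-∩ p q = begin
    subsetOf p ∩ subsetOf q         ≡⟨ cong₂ _∩_ (subsetOf-tabulate p) (subsetOf-tabulate q) ⟩
    tabulate p′ ∩ tabulate q′       ≡⟨ tabulate-∩ p′ q′ ⟩
    tabulate (λ i → p′ i ∧ q′ i)    ≡⟨ subsetOf-tabulate (p ∧ᵖ q) ⟨
    subsetOf (p ∧ᵖ q)               ∎
    where
    open ≡-Reasoning
    p′ q′ : E n → Bool
    p′ i = p (decode i)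
    q′ i = q (decode i)

  decode-x : ∀ a → decode {n} (4 ↑ʳ (a ↑ˡ (K + (K + 0)))) ≡ x a
  decode-x a rewrite splitAt-↑ˡ K a (K + (K + 0)) = refl

  decode-y : ∀ a → decode {n} (4 ↑ʳ (K ↑ʳ (a ↑ˡ (K + 0)))) ≡ y a
  decode-y a rewrite splitAt-↑ʳ K (K + (K + 0)) (a ↑ˡ (K + 0)) | splitAt-↑ˡ K a (K + 0) = refl

  decode-z : ∀ a → decode {n} (4 ↑ʳ (K ↑ʳ (K ↑ʳ (a ↑ˡ 0)))) ≡ z a
  decode-z a rewrite splitAt-↑ʳ K (K + (K + 0)) (K ↑ʳ (a ↑ˡ 0))
                   | splitAt-↑ʳ K (K + 0) (a ↑ˡ 0) | splitAt-↑ˡ K a 0 = refl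

  Constant : (Fin K → Bool) → Set
  Constant f = ∀ a → f a ≡ f zero

  BlockConstant : Pred → Set
  BlockConstant p = Constant (λ a → p (x a)) × Constant (λ a → p (y a)) × Constant (λ a → p (z a))

  ∧ᵖ-blockConstant : ∀ {p q} → BlockConstant p → BlockConstant q → BlockConstant (p ∧ᵖ q)
  ∧ᵖ-blockConstant (px , py , pz) (qx , qy , qz) =
    (λ a → cong₂ _∧_ (px a) (qx a)) , (λ a → cong₂ _∧_ (py a) (qy a)) ,
    (λ a → cong₂ _∧_ (pz a) (qz a))

  fixedCount blockCount : Pred → ℕ
  fixedCount p = ∣ p e1 ∷ p e2 ∷ p e3 ∷ p e4 ∷ [] ∣
  blockCount p = bit (p (x zero)) + (bit (p (y zero)) + bit (p (z zero)))

  ∣block∣ : ∀ p (g : Fin K → Elt n) (pos : Fin K → E n) → (∀ a → decode (pos a) ≡ g a) →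
    Constant (λ a → p (g a)) → ∣ tabulate (λ a → p (decode (pos a))) ∣ ≡ K * bit (p (g zero))
  ∣block∣ p g pos decode-pos const =
    trans (cong ∣_∣ (tabulate-cong (λ a → trans (cong p (decode-pos a)) (const a))))
          (∣tabulate-const∣ K (p (g zero)))

  ∣subsetOf∣ : ∀ p → BlockConstant p → ∣ subsetOf p ∣ ≡ fixedCount p + K * blockCount p
  ∣subsetOf∣ p (px , py , pz) = begin
    ∣ subsetOf p ∣                                     ≡⟨ cong ∣_∣ (subsetOf-tabulate p) ⟩
    ∣ tabulate f ∣                                     ≡⟨ ∣tabulate-+∣ 4 {3 * K} f ⟩
    ∣ tabulate front ∣ + ∣ tabulate blocks ∣            ≡⟨ cong (fixedCount p +_) blockPart ⟩
    fixedCount p + (K * bx + (K * by + (K * bz + 0)))  ≡⟨ cong (fixedCount p +_) distribute ⟩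
    fixedCount p + K * blockCount p                    ∎
    where
    open ≡-Reasoning
    f : E n → Bool
    f i = p (decode i)
    front : Fin 4 → Bool
    front i = f (i ↑ˡ (3 * K))
    blocks : Fin (3 * K) → Bool
    blocks j = f (4 ↑ʳ j)
    bx = bit (p (x zero))
    by = bit (p (y zero))
    bz = bit (p (z zero))
    blockPart : ∣ tabulate blocks ∣ ≡ K * bx + (K * by + (K * bz + 0))
    blockPart =
      trans (∣tabulate-+∣ K blocks) (cong₂ _+_
        (∣block∣ p x (λ a → 4 ↑ʳ (a ↑ˡ (K + (K + 0)))) decode-x px)
        (trans (∣tabulate-+∣ K (λ j → blocks (K ↑ʳ j))) (cong₂ _+_
          (∣block∣ p y (λ a → 4 ↑ʳ (K ↑ʳ (a ↑ˡ (K + 0)))) decode-y py)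
          (trans (∣tabulate-+∣ K (λ j → blocks (K ↑ʳ (K ↑ʳ j)))) (cong₂ _+_
            (∣block∣ p z (λ a → 4 ↑ʳ (K ↑ʳ (K ↑ʳ (a ↑ˡ 0)))) decode-z pz)
            refl)))))
    distribute : K * bx + (K * by + (K * bz + 0)) ≡ K * blockCount p
    distribute = begin
      K * bx + (K * by + (K * bz + 0)) ≡⟨ cong (λ t → K * bx + (K * by + t)) (+-identityʳ (K * bz)) ⟩
      K * bx + (K * by + K * bz)       ≡⟨ cong (K * bx +_) (*-distribˡ-+ K by bz) ⟨
      K * bx + K * (by + bz)           ≡⟨ *-distribˡ-+ K bx (by + bz) ⟨
      K * blockCount p                 ∎

  pattern c₁ = zero
  pattern c₂ = suc zero
  pattern c₃ = suc (suc zero)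
  pattern h₁ = suc (suc (suc zero))
  pattern h₂ = suc (suc (suc (suc zero)))
  pattern h₃ = suc (suc (suc (suc (suc zero))))

  forbidden : Fin 6 → Pred
  forbidden c₁ a = is a e1 ∨ is a e4 ∨ isX a
  forbidden c₂ a = is a e2 ∨ is a e4 ∨ isY a
  forbidden c₃ a = is a e3 ∨ is a e4 ∨ isZ a
  forbidden h₁ a = is a e1 ∨ isY a ∨ isZ a
  forbidden h₂ a = is a e2 ∨ isX a ∨ isZ a
  forbidden h₃ a = is a e3 ∨ isX a ∨ isY a

  triple : Pred
  triple a = is a e1 ∨ is a e2 ∨ is a e3

  F : Fin 6 → Subset (4 + 3 * K)
  F i = subsetOf (forbidden i)

  open SparseFamily (n + 3) (subsetOf triple) F

  forbidden-blockConstant : ∀ i → BlockConstant (forbidden i)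
  forbidden-blockConstant c₁ = (λ _ → refl) , (λ _ → refl) , (λ _ → refl)
  forbidden-blockConstant c₂ = (λ _ → refl) , (λ _ → refl) , (λ _ → refl)
  forbidden-blockConstant c₃ = (λ _ → refl) , (λ _ → refl) , (λ _ → refl)
  forbidden-blockConstant h₁ = (λ _ → refl) , (λ _ → refl) , (λ _ → refl)
  forbidden-blockConstant h₂ = (λ _ → refl) , (λ _ → refl) , (λ _ → refl)
  forbidden-blockConstant h₃ = (λ _ → refl) , (λ _ → refl) , (λ _ → refl)

  -- Two distinct forbidden sets meet in at most one point or one block
  -- ({4}, {i}, X, Y or Z); checked by evaluation on the 30 ordered pairs.
  meetsThin : ∀ i j → i ≢ j →
    fixedCount (forbidden i ∧ᵖ forbidden j) + blockCount (forbidden i ∧ᵖ forbidden j) ≤ 1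
  meetsThin = toWitness {a? = all? λ i → all? λ j → ¬? (i ≟ j) →-dec (_ ≤? 1)} _

  smallMeets : ∀ i j → i ≢ j → suc ∣ F i ∩ F j ∣ < n + 3
  smallMeets i j i≢j = begin-strict
    suc ∣ F i ∩ F j ∣                     ≡⟨ cong (λ s → suc ∣ s ∣) (subsetOf-∩ (forbidden i) (forbidden j)) ⟩
    suc ∣ subsetOf p ∣                    ≡⟨ cong suc (∣subsetOf∣ p p-blockConstant) ⟩
    suc (fixedCount p + K * blockCount p) ≤⟨ s≤s (thin-bound {fixedCount p} n (meetsThin i j i≢j)) ⟩
    suc K                                 <⟨ n<1+n (suc K) ⟩
    3 + n                                 ≡⟨ +-comm 3 n ⟩
    n + 3                                 ∎
    where
    open ≤-Reasoning
    p : Pred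
    p = forbidden i ∧ᵖ forbidden j
    p-blockConstant : BlockConstant p
    p-blockConstant = ∧ᵖ-blockConstant {forbidden i} {forbidden j}
                        (forbidden-blockConstant i) (forbidden-blockConstant j)

  pt₁ pt₂ pt₃ : E n
  pt₁ = zero
  pt₂ = suc zero
  pt₃ = suc (suc zero)

  twoOutside : ∀ i a b → a ≢ b → triple (decode a) ≡ true → triple (decode b) ≡ true →
    forbidden i (decode a) ≡ false → forbidden i (decode b) ≡ false → TwoOutside i
  twoOutside i a b a≢b a∈S b∈S a∉Fi b∉Fi =
    a , b , a≢b , ∈-subsetOf⁺ triple a∈S , ∈-subsetOf⁺ triple b∈S ,
    ∉-subsetOf (forbidden i) a∉Fi , ∉-subsetOf (forbidden i) b∉Fi

  escape : ∀ i → TwoOutside i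
  escape c₁ = twoOutside c₁ pt₂ pt₃ (λ ()) refl refl refl refl
  escape c₂ = twoOutside c₂ pt₁ pt₃ (λ ()) refl refl refl refl
  escape c₃ = twoOutside c₃ pt₁ pt₂ (λ ()) refl refl refl refl
  escape h₁ = twoOutside h₁ pt₂ pt₃ (λ ()) refl refl refl refl
  escape h₂ = twoOutside h₂ pt₁ pt₃ (λ ()) refl refl refl refl
  escape h₃ = twoOutside h₃ pt₁ pt₂ (λ ()) refl refl refl refl

  ⊈-at : ∀ p q a → p (decode a) ≡ true → q (decode a) ≡ false → ¬ subsetOf p ⊆ subsetOf q
  ⊈-at p q a pa qa p⊆q = ∉-subsetOf q qa (p⊆q (∈-subsetOf⁺ p {a} pa))

  onetwoX : Pred
  onetwoX a = is a e1 ∨ is a e2 ∨ isX a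

  basis₀ : IsBasis (subsetOf onetwoX)
  basis₀ = size , ⊈-at triple onetwoX pt₃ refl refl , λ
    { c₁ → ⊈F c₁ pt₂ refl refl ; c₂ → ⊈F c₂ pt₁ refl refl ; c₃ → ⊈F c₃ pt₁ refl refl
    ; h₁ → ⊈F h₁ pt₂ refl refl ; h₂ → ⊈F h₂ pt₁ refl refl ; h₃ → ⊈F h₃ pt₁ refl refl }
    where
    size : ∣ subsetOf onetwoX ∣ ≡ n + 3
    size = trans (∣subsetOf∣ onetwoX ((λ _ → refl) , (λ _ → refl) , (λ _ → refl)))
                 (trans (cong (2 +_) (*-identityʳ K)) (+-comm 3 n))
    ⊈F : ∀ i a → onetwoX (decode a) ≡ true → forbidden i (decode a) ≡ false →
      ¬ subsetOf onetwoX ⊆ F i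
    ⊈F i = ⊈-at onetwoX (forbidden i)

  𝓑⇒IsBasis : ∀ {B} → 𝓑 n B → IsBasis B
  𝓑⇒IsBasis (size , S⊈ , ⊈C₁ , ⊈C₂ , ⊈C₃ , ⊈H₁ , ⊈H₂ , ⊈H₃) = size , S⊈ , λ
    { c₁ → ⊈C₁ ; c₂ → ⊈C₂ ; c₃ → ⊈C₃ ; h₁ → ⊈H₁ ; h₂ → ⊈H₂ ; h₃ → ⊈H₃ }

  IsBasis⇒𝓑 : ∀ {B} → IsBasis B → 𝓑 n B
  IsBasis⇒𝓑 (size , S⊈ , ⊈F) = size , S⊈ , ⊈F c₁ , ⊈F c₂ , ⊈F c₃ , ⊈F h₁ , ⊈F h₂ , ⊈F h₃

  matroid : IsMatroidBases (𝓑 n)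
  matroid = IsMatroidBases-resp IsBasis⇒𝓑 𝓑⇒IsBasis
              (isMatroidBases smallMeets escape (subsetOf onetwoX , basis₀))

lemma5p1 : ∀ (n : ℕ) →
    IsMatroidBases (𝓑 n)
    × (∀ (B : Subset (4 + 3 * suc n)) → 𝓑 n B → ∣ B ∣ ≡ n + 3)
    × ∣ ⊤ {4 + 3 * suc n} ∣ ≡ 3 * n + 7
lemma5p1 n = Construction.matroid n , (λ B B∈𝓑 → proj₁ B∈𝓑) , groundSize
  where
  open ≡-Reasoning
  groundSize : ∣ ⊤ {4 + 3 * suc n} ∣ ≡ 3 * n + 7
  groundSize = begin
    ∣ ⊤ {4 + 3 * suc n} ∣ ≡⟨ ∣⊤∣≡n (4 + 3 * suc n) ⟩
    4 + 3 * suc n         ≡⟨ cong (4 +_) (*-suc 3 n) ⟩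
    7 + 3 * n             ≡⟨ +-comm 7 (3 * n) ⟩
    3 * n + 7             ∎
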